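{- Let $S=\{0,1,\ldots,p-1\}$, let $m\ge 2$, and let $f:S^m\to S$ be a local rule. For nonempty finite words $w$ over $S$ define sets $M_w\subseteq S^m$ recursively by $$M_t=\{u\in S^m : f(u)=t\}\quad (t\in S),\qquad M_{wt}=\{a_2a_3\cdots a_m j : a_1a_2\cdots a_m\in M_w,\ j\in S,\ f(a_2\cdots a_m j)=t\},$$ and for all finite words $w$ (including the empty word $\varepsilon$) define sets $N_w\subseteq S^{m-1}$ recursively by $$N_\varepsilon=S^{m-1},\qquad N_{wt}=\{a_2\cdots a_{m-1}d : a_1\cdots a_{m-1}\in N_w,\ d\in S,\ f(a_1\cdots a_{m-1}d)=t\}.$$ Then for every nonempty finite word $w$ over $S$, $N_w=\{\mathrm{right}_{m-1}(u) : u\in M_w\}$; in particular $M_w=\emptyset$ if and only if $N_w=\emptyset$.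
   Context: For a finite word $x=x_1\cdots x_n$ and $k\le n$, $\mathrm{right}_k(x)=x_{n-k+1}\cdots x_n$ denotes its rightmost $k$ symbols. The sets $M_w$ are the nodes of Amoroso's surjectivity tree (tuples of length $m$), and the sets $N_w$ are the nodes of the simplified tree using tuples of length $m-1$; a node indexed by $w$ corresponds to the path labelled $w$ in the tree. -}

module Defs where

open import Data.Nat using (ℕ; suc)
open import Data.Fin using (Fin)
open import Data.Vec using (Vec; _∷_; _∷ʳ_; tail)
open import Data.Product using (Σ; ∃; _×_; _,_)
open import Relation.Binary.PropositionalEquality using (_≡_)
open import Level using (0ℓ)
open import Data.Unit using (⊤)
open import Relation.Unary using (Pred)

S : ℕ → Set
S p = Fin p

-- Finite words built by appending letters on the right (snoc lists),
-- matching the recursion on wt.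
data Word (p : ℕ) : Set where
  ε   : Word p
  _▷_ : Word p → S p → Word p

-- Throughout, m = suc n, so S^m = Vec (S p) (suc n) and S^(m-1) = Vec (S p) n.
-- A local rule f : S^m → S.

-- M_w for the nonempty word  w ▷ t  (w possibly empty).
M : ∀ {p n} → (Vec (S p) (suc n) → S p) → Word p → S p → Pred (Vec (S p) (suc n)) 0ℓ
M f ε       t v = f v ≡ t
M f (w ▷ s) t v = Σ (Vec _ _) λ u → Σ (S _) λ j →
  M f w s u × f (tail u ∷ʳ j) ≡ t × v ≡ tail u ∷ʳ j

N : ∀ {p n} → (Vec (S p) (suc n) → S p) → Word p → Pred (Vec (S p) n) 0ℓ
N f ε       a = ⊤
N f (w ▷ t) v = Σ (Vec _ _) λ a → Σ (S _) λ d →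
  N f w a × f (a ∷ʳ d) ≡ t × v ≡ tail (a ∷ʳ d)

right : ∀ {A : Set} {n} → Vec A (suc n) → Vec A n
right = tail

{-# OPTIONS --safe #-}
module Submission where

-- Both trees follow the same sliding window: a node of M_{wt} is exactly a
-- word a ∷ʳ d with f (a ∷ʳ d) ≡ t and a ∈ N_w.  Dropping the first letter of
-- such a word is, by definition, producing an element of N_{wt}.

open import Defs
open import Data.Nat using (ℕ; suc; _≤_)
open import Data.Vec using (Vec; _∷ʳ_; initLast)
open import Data.Product using (Σ; ∃₂; _×_; _,_)
open import Data.Empty using (⊥)
open import Function.Bundles using (_⇔_; mk⇔; Equivalence)
open import Relation.Binary.PropositionalEquality using (_≡_; refl; sym; trans; cong; subst)

empty⇔image-empty : ∀ {A B : Set} {P : A → Set} {Q : B → Set} (g : B → A) →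
  (∀ a → P a ⇔ Σ B λ b → Q b × g b ≡ a) →
  (∀ b → Q b → ⊥) ⇔ (∀ a → P a → ⊥)
empty⇔image-empty g P⇔image = mk⇔
  (λ ¬Q a Pa → let (b , Qb , _) = Equivalence.to (P⇔image a) Pa in ¬Q b Qb)
  (λ ¬P b Qb → ¬P (g b) (Equivalence.from (P⇔image (g b)) (b , Qb , refl)))

module _ {p n : ℕ} (f : Vec (S p) (suc n) → S p) where

  M⇒rule : ∀ w t u → M f w t u → f u ≡ t
  M⇒rule ε       t u               fu                        = fu
  M⇒rule (w ▷ s) t .(right u ∷ʳ j) (u , j , _ , fv , refl) = fv

  M⇒N-∷ʳ : ∀ w t u → M f w t u → ∃₂ λ a d → N f w a × u ≡ a ∷ʳ d
  M⇒N-∷ʳ ε t u _ with initLast u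
  ... | a , d , u≡ = a , d , _ , u≡
  M⇒N-∷ʳ (w ▷ s) t .(right u ∷ʳ j) (u , j , Mu , _ , refl)
    with M⇒N-∷ʳ w s u Mu
  ... | a , d , Na , refl =
    right (a ∷ʳ d) , j , (a , d , Na , M⇒rule w s (a ∷ʳ d) Mu , refl) , refl

  N⇒M-∷ʳ : ∀ w t a d → N f w a → f (a ∷ʳ d) ≡ t → M f w t (a ∷ʳ d)
  N⇒M-∷ʳ ε       t a                 d _                             fad = fad
  N⇒M-∷ʳ (w ▷ s) t .(right (b ∷ʳ e)) d (b , e , Nb , fbe , refl) fad =
    b ∷ʳ e , d , N⇒M-∷ʳ w s b e Nb fbe , fad , refl

  N-▷⇔right-M : ∀ w t v → N f (w ▷ t) v ⇔ Σ (Vec (S p) (suc n)) λ u → M f w t u × right u ≡ v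
  N-▷⇔right-M w t v = mk⇔ to from
    where
    to : N f (w ▷ t) v → Σ (Vec (S p) (suc n)) λ u → M f w t u × right u ≡ v
    to (a , d , Na , fad , v≡) = a ∷ʳ d , N⇒M-∷ʳ w t a d Na fad , sym v≡

    from : (Σ (Vec (S p) (suc n)) λ u → M f w t u × right u ≡ v) → N f (w ▷ t) v
    from (u , Mu , right-u≡v) with M⇒N-∷ʳ w t u Mu
    ... | a , d , Na , u≡ =
      a , d , Na , subst (λ x → f x ≡ t) u≡ (M⇒rule w t u Mu) ,
      trans (sym right-u≡v) (cong right u≡)

lemma1 : (p n : ℕ) → 1 ≤ n → (f : Vec (S p) (suc n) → S p) →
    (w : Word p) (t : S p) →
      (∀ (v : Vec (S p) n) → (N f (w ▷ t) v ⇔ Σ (Vec (S p) (suc n)) λ u → M f w t u × right u ≡ v))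
      × ((∀ u → M f w t u → ⊥) ⇔ (∀ v → N f (w ▷ t) v → ⊥))
lemma1 p n _ f w t = N-▷⇔right-M f w t , empty⇔image-empty right (N-▷⇔right-M f w t)
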